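{- Let $G$ be a connected finite simple graph and let $S$ be a set of vertices of $G$, each of degree $1$ in $G$. If the girth of $G$ is greater than $|S|$, then $G$ has an induced subgraph which is a tree containing $S$.
   Context: The girth of a graph is the minimum length of a cycle in it (infinite if the graph has no cycle). -}

module Defs where

open import Data.Nat using (ℕ; suc; _<_; _≤_)
open import Data.Bool using (Bool; true; false; if_then_else_)
open import Data.Fin using (Fin)
open import Data.Fin.Subset using (Subset; _∈_; _⊆_; ∣_∣)
open import Data.Nat.ListAction using (sum)
open import Data.List using (List; []; _∷_; length; map; allFin; _∷ʳ_)
open import Data.List.Relation.Unary.All using (All)
open import Data.List.Relation.Unary.Linked using (Linked)
open import Data.List.Relation.Unary.Unique.Propositional using (Unique)
open import Data.Product using (Σ; ∃; _×_)
open import Relation.Binary.PropositionalEquality using (_≡_)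
open import Relation.Nullary using (¬_)

record Graph (n : ℕ) : Set where
  field
    adj    : Fin n → Fin n → Bool
    sym    : ∀ u v → adj u v ≡ adj v u
    loopless : ∀ v → adj v v ≡ false
open Graph public

E : ∀ {n} → Graph n → Fin n → Fin n → Set
E G u v = adj G u v ≡ true

degree : ∀ {n} → Graph n → Fin n → ℕ
degree {n} G v = sum (map (λ u → if adj G v u then 1 else 0) (allFin n))

-- Walks from u to v all of whose vertices after u lie in the vertex set T.
data WalkIn {n} (G : Graph n) (T : Subset n) : Fin n → Fin n → Set where
  here : ∀ {u} → WalkIn G T u u
  step : ∀ {u w v} → E G u w → w ∈ T → WalkIn G T w v → WalkIn G T u v

InducedConnected : ∀ {n} → Graph n → Subset n → Set
InducedConnected G T =
  (∃ λ v → v ∈ T) × (∀ u v → u ∈ T → v ∈ T → WalkIn G T u v)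

record CycleIn {n} (G : Graph n) (T : Subset n) : Set where
  field
    start  : Fin n
    rest   : List (Fin n)
    long   : 3 ≤ length (start ∷ rest)
    closed : Linked (E G) ((start ∷ rest) ∷ʳ start)
    simple : Unique (start ∷ rest)
    inside : All (_∈ T) (start ∷ rest)

cycleLength : ∀ {n} {G : Graph n} {T : Subset n} → CycleIn G T → ℕ
cycleLength c = length (CycleIn.start c ∷ CycleIn.rest c)

everything : ∀ n → Subset n
everything n = Data.Fin.Subset.⊤

Connected : ∀ {n} → Graph n → Set
Connected {n} G = InducedConnected G (everything n)

-- girth G > m  (every cycle of G has length > m; vacuous if acyclic,
-- i.e. infinite girth).
GirthGreaterThan : ∀ {n} → Graph n → ℕ → Set
GirthGreaterThan {n} G m = (c : CycleIn G (everything n)) → m < cycleLength c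

InducedTree : ∀ {n} → Graph n → Subset n → Set
InducedTree G T = InducedConnected G T × ¬ CycleIn G T

{-# OPTIONS --safe #-}
-- Choose T minimal under inclusion such that S ⊆ T and G[T] is connected (the whole vertex
-- set qualifies). Suppose G[T] contains a cycle C. For a vertex c of C, the component R c of
-- G[T - c] containing C - c is connected and strictly smaller than T, so by minimality some
-- s c ∈ S lies outside R c. A vertex of T whose walk to C first meets C at e lies in R c for
-- every c ≠ e; hence c ↦ s c is injective and |C| ≤ |S|, contradicting girth G > |S|.
-- So G[T] is a tree.
module Submission where

open import Defs
open import Data.Nat using (ℕ)
open import Data.Fin.Subset using (Subset; _∈_; _⊆_; ∣_∣)
open import Data.Product using (Σ; _×_)
open import Relation.Binary.PropositionalEquality using (_≡_)

open import Level using (Level)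
open import Function using (_∘_)
open import Data.Bool using (true)
import Data.Bool as Bool
open import Data.Empty using (⊥-elim)
open import Data.Nat using (suc; zero; _≤_; z≤n; s≤s)
open import Data.Nat.Properties using (≤-trans; <⇒≱; n≤1+n; m≤n⇒m≤1+n)
open import Data.Fin using (Fin; _≟_)
import Data.Fin.Properties as Fin
open import Data.Fin.Subset using (_∉_; _⊈_; _⊂_; _-_; ⊤)
open import Data.Fin.Subset.Properties
  using (_∈?_; _⊆?_; _⊂?_; anySubset?; ∈⊤; ∣⊤∣≡n; x∈p∧x≢y⇒x∈p-y; x∈p⇒∣p-x∣<∣p∣; x∈p⇒p-x⊂p;
         ⊆-⊂-trans)
open import Data.Fin.Subset.Induction using (Acc; acc; ⊂-wellFounded)
open import Data.List using (List; []; _∷_; _++_; _∷ʳ_; [_]; length)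
open import Data.List.Properties using (++-assoc; ++-identityʳ)
open import Data.List.Membership.Propositional using () renaming (_∈_ to _∈ₗ_; _∉_ to _∉ₗ_)
open import Data.List.Membership.Propositional.Properties using (∈-∃++; ∈-++⁺ˡ; ∈-++⁺ʳ; ∈-++⁻)
open import Data.List.Relation.Unary.Any as Any using (here; there)
open import Data.List.Relation.Unary.All as All using (All; []; _∷_)
open import Data.List.Relation.Unary.All.Properties using (¬Any⇒All¬; All¬⇒¬Any)
open import Data.List.Relation.Unary.AllPairs using ([]; _∷_)
open import Data.List.Relation.Unary.Linked as Linked using (Linked; []; [-]; _∷_)
open import Data.List.Relation.Unary.Unique.Propositional using (Unique)
open import Data.Product as Product using (_,_; proj₁; proj₂; ∃)
open import Data.Sum using (_⊎_; inj₁; inj₂)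
open import Data.Vec using (tabulate)
open import Data.Vec.Properties using (lookup∘tabulate; lookup⇒[]=; []=⇒lookup)
open import Relation.Binary.Core using (Rel)
open import Relation.Binary.PropositionalEquality as ≡ using (refl; _≢_; subst)
open import Relation.Nullary using (¬_; Dec; yes; no; does; proof)
open import Relation.Nullary.Reflects using (Reflects; invert)
open import Relation.Nullary.Decidable using (_×-dec_; _⊎-dec_; _→-dec_; map′; dec-true; decidable-stable)
open import Relation.Unary using (Pred; Decidable)

private
  variable
    a ℓ : Level
    A : Set a
    n : ℕ

⊈⇒∃∉ : ∀ {p q : Subset n} → p ⊈ q → ∃ λ x → x ∈ p × x ∉ q
⊈⇒∃∉ {n} {p} {q} p⊈q
  with x , ¬[x∈p⇒x∈q] ← Fin.¬∀⟶∃¬ n (λ x → x ∈ p → x ∈ q) (λ x → x ∈? p →-dec x ∈? q)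
                                     (λ p⊆q → p⊈q (p⊆q _))
  with x ∈? p
... | yes x∈p = x , x∈p , λ x∈q → ¬[x∈p⇒x∈q] (λ _ → x∈q)
... | no  x∉p = ⊥-elim (¬[x∈p⇒x∈q] (⊥-elim ∘ x∉p))

comprehension : {P : Pred (Fin n) ℓ} → Decidable P → Subset n
comprehension P? = tabulate (does ∘ P?)

module _ {P : Pred (Fin n) ℓ} (P? : Decidable P) {x : Fin n} where

  ∈-comprehension⁺ : P x → x ∈ comprehension P?
  ∈-comprehension⁺ Px = lookup⇒[]= x _ (≡.trans (lookup∘tabulate (does ∘ P?) x) (dec-true (P? x) Px))

  ∈-comprehension⁻ : x ∈ comprehension P? → P x
  ∈-comprehension⁻ x∈ = invert (subst (Reflects (P x)) does≡true (proof (P? x)))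
    where does≡true = ≡.trans (≡.sym (lookup∘tabulate (does ∘ P?) x)) ([]=⇒lookup x∈)

⊂-minimal : {P : Pred (Subset n) ℓ} → Decidable P →
            ∀ {p} → P p → ∃ λ q → P q × (∀ {r} → r ⊂ q → ¬ P r)
⊂-minimal {P = P} P? = descend (⊂-wellFounded _)
  where
  descend : ∀ {p} → Acc _⊂_ p → P p → ∃ λ q → P q × (∀ {r} → r ⊂ q → ¬ P r)
  descend {p} (acc smaller) Pp with anySubset? (λ r → r ⊂? p ×-dec P? r)
  ... | yes (r , r⊂p , Pr) = descend (smaller r⊂p) Pr
  ... | no  ∄r             = p , Pp , λ {r} r⊂p Pr → ∄r (r , r⊂p , Pr)

length≤∣∣ : ∀ (p : Subset n) {xs : List A} → Unique xs →
            (f : ∀ {x} → x ∈ₗ xs → Fin n) → (∀ {x} (x∈ : x ∈ₗ xs) → f x∈ ∈ p) →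
            (∀ {x y} (x∈ : x ∈ₗ xs) (y∈ : y ∈ₗ xs) → f x∈ ≡ f y∈ → x ≡ y) →
            length xs ≤ ∣ p ∣
length≤∣∣ p []                  f f∈p f-injective = z≤n
length≤∣∣ p (x∉xs ∷ xs-unique) f f∈p f-injective =
  ≤-trans (s≤s (length≤∣∣ (p - f (here refl)) xs-unique (λ y∈ → f (there y∈)) f′∈p′
                 (λ y∈ z∈ → f-injective (there y∈) (there z∈))))
          (x∈p⇒∣p-x∣<∣p∣ (f∈p (here refl)))
  where
  f′∈p′ : ∀ {y} (y∈ : y ∈ₗ _) → f (there y∈) ∈ p - f (here refl)
  f′∈p′ y∈ = x∈p∧x≢y⇒x∈p-y (f∈p (there y∈))
    (λ fy≡fx → All.lookup x∉xs y∈ (≡.sym (f-injective (there y∈) (here refl) fy≡fx)))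

Unique⇒length≤ : ∀ {xs : List (Fin n)} → Unique xs → length xs ≤ n
Unique⇒length≤ {n} {xs} xs-unique =
  subst (length xs ≤_) (∣⊤∣≡n n)
    (length≤∣∣ ⊤ xs-unique (λ {x} _ → x) (λ _ → ∈⊤) (λ _ _ x≡y → x≡y))

another-element : ∀ {xs : List (Fin n)} → Unique xs → 2 ≤ length xs →
                  ∀ c → ∃ λ a → a ∈ₗ xs × a ≢ c
another-element {xs = []}        _                 ()
another-element {xs = _ ∷ []}    _                 (s≤s ())
another-element {xs = x ∷ y ∷ _} ((x≢y ∷ _) ∷ _) _ c with c ≟ x
... | yes refl = y , there (here refl) , x≢y ∘ ≡.sym
... | no  c≢x  = x , here refl , c≢x ∘ ≡.sym

Unique⇒middle∉ : ∀ pre {c : A} {post} → Unique (pre ++ c ∷ post) → c ∉ₗ pre × c ∉ₗ post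
Unique⇒middle∉ []        (c∉post ∷ _) = (λ ()) , All¬⇒¬Any c∉post
Unique⇒middle∉ (x ∷ pre) (x∉ ∷ unique) with c∉pre , c∉post ← Unique⇒middle∉ pre unique =
    (λ { (here c≡x) → All.lookup x∉ (∈-++⁺ʳ pre (here refl)) (≡.sym c≡x)
       ; (there c∈)  → c∉pre c∈ })
  , c∉post

module _ (pre : List A) {c : A} {post : List A} {x : A} where

  ∈-rotate⁻ : x ∈ₗ post ++ pre → x ∈ₗ pre ++ c ∷ post
  ∈-rotate⁻ x∈ with ∈-++⁻ post x∈
  ... | inj₁ x∈post = ∈-++⁺ʳ pre (there x∈post)
  ... | inj₂ x∈pre  = ∈-++⁺ˡ x∈pre

  ∈-rotate⁺ : x ∈ₗ pre ++ c ∷ post → x ≢ c → x ∈ₗ post ++ pre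
  ∈-rotate⁺ x∈ x≢c with ∈-++⁻ pre x∈
  ... | inj₁ x∈pre          = ∈-++⁺ʳ post x∈pre
  ... | inj₂ (here x≡c)     = ⊥-elim (x≢c x≡c)
  ... | inj₂ (there x∈post) = ∈-++⁺ˡ x∈post

  ∈-rotate⇒≢ : Unique (pre ++ c ∷ post) → x ∈ₗ post ++ pre → x ≢ c
  ∈-rotate⇒≢ unique x∈ refl with c∉pre , c∉post ← Unique⇒middle∉ pre unique with ∈-++⁻ post x∈
  ... | inj₁ c∈post = c∉post c∈post
  ... | inj₂ c∈pre  = c∉pre c∈pre

module _ {R : Rel A ℓ} where

  Linked-++⁻ : ∀ xs {ys} → Linked R (xs ++ ys) → Linked R xs × Linked R ys
  Linked-++⁻ []           linked       = [] , linked
  Linked-++⁻ (x ∷ [])     linked       = [-] , Linked.tail linked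
  Linked-++⁻ (x ∷ y ∷ xs) (r ∷ linked) = Product.map₁ (r ∷_) (Linked-++⁻ (y ∷ xs) linked)

  Linked-glue : ∀ xs {a ys} → Linked R (xs ∷ʳ a) → Linked R (a ∷ ys) → Linked R (xs ++ a ∷ ys)
  Linked-glue []           _              linked = linked
  Linked-glue (x ∷ [])     (r ∷ _)        linked = r ∷ linked
  Linked-glue (x ∷ y ∷ xs) (r ∷ linked′) linked = r ∷ Linked-glue (y ∷ xs) linked′ linked

  Linked-rotate : ∀ {s r} pre {c} post → s ∷ r ≡ pre ++ c ∷ post →
                  Linked R ((s ∷ r) ∷ʳ s) → Linked R (post ++ pre)
  Linked-rotate []        post refl closed =
    subst (Linked R) (≡.sym (++-identityʳ post)) (proj₁ (Linked-++⁻ post (Linked.tail closed)))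
  Linked-rotate (x ∷ pre) {c} post refl closed
    with pre-linked , post-closed ←
           Linked-++⁻ (x ∷ pre) (subst (Linked R) (++-assoc (x ∷ pre) (c ∷ post) [ x ]) closed)
    = Linked-glue post (Linked.tail post-closed) pre-linked

  cycle-minus-path : ∀ {s r c} → Linked R ((s ∷ r) ∷ʳ s) → Unique (s ∷ r) → c ∈ₗ s ∷ r →
                     ∃ λ P → Linked R P × (∀ {x} → x ∈ₗ P → x ∈ₗ s ∷ r × x ≢ c)
                                        × (∀ {x} → x ∈ₗ s ∷ r → x ≢ c → x ∈ₗ P)
  cycle-minus-path {s} {r} {c} closed unique c∈ with pre , post , cycle≡ ← ∈-∃++ c∈ =
      post ++ pre
    , Linked-rotate pre post cycle≡ closed
    , (λ x∈ → subst (_ ∈ₗ_) (≡.sym cycle≡) (∈-rotate⁻ pre x∈)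
            , ∈-rotate⇒≢ pre (subst Unique cycle≡ unique) x∈)
    , (λ x∈ → ∈-rotate⁺ pre (subst (_ ∈ₗ_) cycle≡ x∈))

module _ (G : Graph n) where

  E-sym : ∀ {u v} → E G u v → E G v u
  E-sym {u} {v} u~v = ≡.trans (Graph.sym G v u) u~v

  snoc : ∀ {T u v w} → WalkIn G T u v → E G v w → w ∈ T → WalkIn G T u w
  snoc here           v~w w∈T = step v~w w∈T here
  snoc (step e x∈T p) v~w w∈T = step e x∈T (snoc p v~w w∈T)

  _++ʷ_ : ∀ {T u v w} → WalkIn G T u v → WalkIn G T v w → WalkIn G T u w
  here           ++ʷ q = q
  step e x∈T p ++ʷ q = step e x∈T (p ++ʷ q)

  reverse : ∀ {T u v} → WalkIn G T u v → u ∈ T → WalkIn G T v u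
  reverse here           _   = here
  reverse (step e x∈T p) u∈T = snoc (reverse p x∈T) (E-sym e) u∈T

  vertices : ∀ {T u v} → WalkIn G T u v → List (Fin n)
  vertices {u = u} here         = u ∷ []
  vertices {u = u} (step _ _ p) = u ∷ vertices p

  BoundedWalk : Subset n → ℕ → Fin n → Fin n → Set
  BoundedWalk T zero    u v = u ≡ v
  BoundedWalk T (suc k) u v = u ≡ v ⊎ ∃ λ w → (E G u w × w ∈ T) × BoundedWalk T k w v

  boundedWalk? : ∀ T k u v → Dec (BoundedWalk T k u v)
  boundedWalk? T zero    u v = u ≟ v
  boundedWalk? T (suc k) u v =
    u ≟ v ⊎-dec Fin.any? (λ w → (adj G u w Bool.≟ true ×-dec w ∈? T) ×-dec boundedWalk? T k w v)

  BoundedWalk⇒WalkIn : ∀ {T} k {u v} → BoundedWalk T k u v → WalkIn G T u v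
  BoundedWalk⇒WalkIn zero    refl                         = here
  BoundedWalk⇒WalkIn (suc k) (inj₁ refl)                  = here
  BoundedWalk⇒WalkIn (suc k) (inj₂ (w , (u~w , w∈T) , p)) = step u~w w∈T (BoundedWalk⇒WalkIn k p)

  WalkIn⇒BoundedWalk : ∀ {T u v} (p : WalkIn G T u v) k → length (vertices p) ≤ suc k → BoundedWalk T k u v
  WalkIn⇒BoundedWalk here                    zero    _        = refl
  WalkIn⇒BoundedWalk here                    (suc k) _        = inj₁ refl
  WalkIn⇒BoundedWalk (step _ _ here)         zero    (s≤s ())
  WalkIn⇒BoundedWalk (step _ _ (step _ _ _)) zero    (s≤s ())
  WalkIn⇒BoundedWalk (step e w∈T p)          (suc k) (s≤s ≤k) =
    inj₂ (_ , (e , w∈T) , WalkIn⇒BoundedWalk p k ≤k)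

  UniqueWalk : Subset n → Fin n → Fin n → Set
  UniqueWalk T u v = Σ (WalkIn G T u v) (Unique ∘ vertices)

  suffix : ∀ {T u w v} (p : WalkIn G T w v) → Unique (vertices p) → u ∈ₗ vertices p → UniqueWalk T u v
  suffix here          unique       (here refl) = here , unique
  suffix p@(step _ _ _) unique       (here refl) = p , unique
  suffix (step _ _ p)   (_ ∷ unique) (there u∈)  = suffix p unique u∈

  erase-loops : ∀ {T u v} → WalkIn G T u v → UniqueWalk T u v
  erase-loops here = here , [] ∷ []
  erase-loops {u = u} (step e w∈T p) with q , q-unique ← erase-loops p with Any.any? (u ≟_) (vertices q)
  ... | yes u∈q = suffix q q-unique u∈q
  ... | no  u∉q = step e w∈T q , ¬Any⇒All¬ _ u∉q ∷ q-unique

  -- Loop erasure shortens any walk to at most n vertices, so searching walks of n steps suffices.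
  walk? : ∀ T u v → Dec (WalkIn G T u v)
  walk? T u v = map′ (BoundedWalk⇒WalkIn n) shorten (boundedWalk? T n u v)
    where
    shorten : WalkIn G T u v → BoundedWalk T n u v
    shorten p with q , q-unique ← erase-loops p =
      WalkIn⇒BoundedWalk q n (m≤n⇒m≤1+n (Unique⇒length≤ q-unique))

  connected? : ∀ T → Dec (InducedConnected G T)
  connected? T =
    Fin.any? (_∈? T) ×-dec Fin.all? λ u → Fin.all? λ v → u ∈? T →-dec (v ∈? T →-dec walk? T u v)

  Connects : Subset n → Subset n → Set
  Connects S T = S ⊆ T × InducedConnected G T

  connects? : ∀ S T → Dec (Connects S T)
  connects? S T = S ⊆? T ×-dec connected? T

  component : Subset n → Fin n → Subset n
  component T a = comprehension (λ x → x ∈? T ×-dec walk? T a x)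

  module _ {T : Subset n} {a : Fin n} where

    ∈-component⁺ : ∀ {x} → x ∈ T → WalkIn G T a x → x ∈ component T a
    ∈-component⁺ x∈T a⇝x = ∈-comprehension⁺ (λ x → x ∈? T ×-dec walk? T a x) (x∈T , a⇝x)

    ∈-component⁻ : ∀ {x} → x ∈ component T a → x ∈ T × WalkIn G T a x
    ∈-component⁻ = ∈-comprehension⁻ (λ x → x ∈? T ×-dec walk? T a x)

    component-⊆ : component T a ⊆ T
    component-⊆ = proj₁ ∘ ∈-component⁻

    component-closed : ∀ {x y} → y ∈ component T a → E G x y → x ∈ T → x ∈ component T a
    component-closed y∈ x~y x∈T =
      ∈-component⁺ x∈T (snoc (proj₂ (∈-component⁻ y∈)) (E-sym x~y) x∈T)

    walk-in-component : ∀ {x y} → WalkIn G T a x → WalkIn G T x y → WalkIn G (component T a) x y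
    walk-in-component a⇝x here             = here
    walk-in-component a⇝x (step e z∈T z⇝y) =
      step e (∈-component⁺ z∈T a⇝z) (walk-in-component a⇝z z⇝y)
      where a⇝z = snoc a⇝x e z∈T

    component-connected : a ∈ T → InducedConnected G (component T a)
    component-connected a∈T = (a , ∈-component⁺ a∈T here) , λ u v u∈ v∈ →
      let a⇝u = proj₂ (∈-component⁻ u∈) in
      walk-in-component a⇝u (reverse a⇝u a∈T ++ʷ proj₂ (∈-component⁻ v∈))

  walk-along : ∀ {T a P x} → Linked (E G) (a ∷ P) → All (_∈ T) P → x ∈ₗ a ∷ P → WalkIn G T a x
  walk-along _            _            (here refl) = here
  walk-along (e ∷ linked) (b∈T ∷ P⊆T) (there x∈)  = step e b∈T (walk-along linked P⊆T x∈)

  walk-within-path : ∀ {T P x y} → Linked (E G) P → All (_∈ T) P →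
                     x ∈ₗ P → y ∈ₗ P → WalkIn G T x y
  walk-within-path {P = _ ∷ _} linked (a∈T ∷ P⊆T) x∈ y∈ =
    reverse (walk-along linked P⊆T x∈) a∈T ++ʷ walk-along linked P⊆T y∈

  CycleIn-mono : ∀ {T T′} → T ⊆ T′ → CycleIn G T → CycleIn G T′
  CycleIn-mono T⊆T′ C = record { CycleIn C ; inside = All.map T⊆T′ (CycleIn.inside C) }

  module _ {T : Subset n} (C : CycleIn G T) where

    open CycleIn C

    cycle : List (Fin n)
    cycle = start ∷ rest

    C-c⊆T-c : ∀ {c x} → x ∈ₗ cycle → x ≢ c → x ∈ T - c
    C-c⊆T-c x∈C = x∈p∧x≢y⇒x∈p-y (All.lookup inside x∈C)

    cycle-minus-connected : ∀ {c x y} → c ∈ₗ cycle → x ∈ₗ cycle → y ∈ₗ cycle →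
                            x ≢ c → y ≢ c → WalkIn G (T - c) x y
    cycle-minus-connected c∈ x∈ y∈ x≢c y≢c
      with P , P-linked , P⊆C-c , C-c⊆P ← cycle-minus-path closed simple c∈ =
      walk-within-path P-linked
        (All.tabulate (λ z∈ → C-c⊆T-c (proj₁ (P⊆C-c z∈)) (proj₂ (P⊆C-c z∈))))
        (C-c⊆P x∈ x≢c) (C-c⊆P y∈ y≢c)

    module _ {S : Subset n} (T-connects : Connects S T)
             (minimal : ∀ {T′} → T′ ⊂ T → ¬ Connects S T′) where

      private
        S⊆T = proj₁ T-connects
        T-connected = proj₂ T-connects

        another : ∀ c → ∃ λ a → a ∈ₗ cycle × a ≢ c
        another = another-element simple (≤-trans (n≤1+n 2) long)

        -- R c is the component of G[T - c] containing the rest of the cycle.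
        R : Fin n → Subset n
        R c = component (T - c) (proj₁ (another c))

        C-c⊆R : ∀ {c c′} → c ∈ₗ cycle → c′ ∈ₗ cycle → c′ ≢ c → c′ ∈ R c
        C-c⊆R {c} c∈ c′∈ c′≢c with _ , a∈ , a≢c ← another c =
          ∈-component⁺ (C-c⊆T-c c′∈ c′≢c) (cycle-minus-connected c∈ a∈ c′∈ a≢c c′≢c)

        R-misses-S : ∀ {c} → c ∈ₗ cycle → ∃ λ s → s ∈ S × s ∉ R c
        R-misses-S {c} c∈ with _ , a∈ , a≢c ← another c = ⊈⇒∃∉ λ S⊆R → minimal
          (⊆-⊂-trans component-⊆ (x∈p⇒p-x⊂p (All.lookup inside c∈)))
          (S⊆R , component-connected (C-c⊆T-c a∈ a≢c))

        -- A walk from x to the cycle first meets it at some e; the part before e avoids every other c.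
        walk-enters-cycle : ∀ {x y} → x ∈ T → WalkIn G T x y → y ∈ₗ cycle →
                            ∃ λ e → ∀ {c} → c ∈ₗ cycle → c ≢ e → x ∈ R c
        walk-enters-cycle {x} x∈T x⇝y y∈C with Any.any? (x ≟_) cycle
        ... | yes x∈C = x , λ c∈ c≢x → C-c⊆R c∈ x∈C (c≢x ∘ ≡.sym)
        walk-enters-cycle x∈T here y∈C | no x∉C = ⊥-elim (x∉C y∈C)
        walk-enters-cycle x∈T (step x~w w∈T w⇝y) y∈C | no x∉C
          with e , w∈R ← walk-enters-cycle w∈T w⇝y y∈C =
          e , λ c∈ c≢e →
            component-closed (w∈R c∈ c≢e) x~w (x∈p∧x≢y⇒x∈p-y x∈T λ { refl → x∉C c∈ })

        enters-cycle : ∀ {x} → x ∈ T → ∃ λ e → ∀ {c} → c ∈ₗ cycle → c ≢ e → x ∈ R c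
        enters-cycle x∈T =
          walk-enters-cycle x∈T (proj₂ T-connected _ start x∈T (All.lookup inside (here refl))) (here refl)

        ∉R⇒entry : ∀ {x c} (x∈T : x ∈ T) → c ∈ₗ cycle → x ∉ R c → c ≡ proj₁ (enters-cycle x∈T)
        ∉R⇒entry x∈T c∈ x∉Rc =
          decidable-stable (_ ≟ _) λ c≢e → x∉Rc (proj₂ (enters-cycle x∈T) c∈ c≢e)

      cycle-length≤∣S∣ : cycleLength C ≤ ∣ S ∣
      cycle-length≤∣S∣ =
        length≤∣∣ S simple (proj₁ ∘ R-misses-S) (proj₁ ∘ proj₂ ∘ R-misses-S) injective
        where
        injective : ∀ {c c′} (c∈ : c ∈ₗ cycle) (c′∈ : c′ ∈ₗ cycle) →
                    proj₁ (R-misses-S c∈) ≡ proj₁ (R-misses-S c′∈) → c ≡ c′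
        injective c∈ c′∈ same =
          ≡.trans (∉R⇒entry s∈T c∈ (proj₂ (proj₂ (R-misses-S c∈))))
                  (≡.sym (∉R⇒entry s∈T c′∈ (subst (_∉ R _) (≡.sym same) (proj₂ (proj₂ (R-misses-S c′∈))))))
          where s∈T = S⊆T (proj₁ (proj₂ (R-misses-S c∈)))

lemma2p1 : (n : ℕ) (G : Graph n) (S : Subset n)
    → Connected G
    → (∀ v → v ∈ S → degree G v ≡ 1)
    → GirthGreaterThan G ∣ S ∣
    → Σ (Subset n) (λ T → S ⊆ T × InducedTree G T)
lemma2p1 n G S G-connected _ girth>∣S∣
  with T , T-connects , minimal ← ⊂-minimal (connects? G S) ((λ _ → ∈⊤) , G-connected) =
  T , proj₁ T-connects , proj₂ T-connects ,
  λ C → <⇒≱ (girth>∣S∣ (CycleIn-mono G (λ _ → ∈⊤) C))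
             (cycle-length≤∣S∣ G C T-connects minimal)
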